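{- Let $S$ be a finite set, let $F$ be the free group on $S$, and let $R$ be a finite set of words over $S \cup S^{ -1}$ (the relators). Let $U = v_1\, r_1^{\epsilon_1}\, v_2\, r_2^{\epsilon_2} \cdots v_N\, r_N^{\epsilon_N}\, v_{N+1}$ be any reduced proof word (with $N \ge 1$, $r_i \in R$, $\epsilon_i \in \{1,-1\}$, and each $v_i$ a freely reduced word). Then $U$ can be generated from the empty word $\varepsilon$ by a finite sequence of relator append moves and conjugation moves; that is, some finite sequence of such moves starting from $\varepsilon$ produces a marked word which, after freely reducing each of its segments lying outside the marked relator occurrences, is equal to $U$.
   Context: A proof word is a formal (not freely reduced) product $\prod_{i=1}^{N} u_i^{ -1} r_i^{\pm 1} u_i$ with $r_i \in R$ and $u_i \in F$, in which the occurrences of the relators $r_i^{\pm1}$ are kept marked (delimited) and are never cancelled against the surrounding letters. Writing such a product as $v_1\, r_1^{\pm1}\, v_2\, r_2^{\pm1} \cdots v_N\, r_N^{\pm1}\, v_{N+1}$, where $v_1$ is the word $u_1^{ -1}$, $v_i$ is the word $u_{i-1}u_i^{ -1}$ for $2 \le i \le N$, and $v_{N+1}$ is the word $u_N$, the proof word is called reduced if each of the words $v_1, \dots, v_{N+1}$ is freely reduced. Moves act on marked words of this kind (strings over $S \cup S^{ -1}$ with some marked relator occurrences): a conjugation move replaces a marked word $W$ by $x^{ -1} W x$ for some $x \in S \cup S^{ -1}$ (the letters $x^{ -1}, x$ lie outside the marked relators); a relator append move replaces $W$ by $W r^{\pm 1}$ for some $r \in R$, the appended copy of $r^{\pm1}$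 being marked. Free reduction is only ever performed on the unmarked segments between (and before/after) the marked relator occurrences. -}

module Defs where

open import Data.Nat using (ℕ)
open import Data.Fin using (Fin)
open import Data.Bool using (Bool; true; false; not)
open import Data.Product using (_×_; _,_)
open import Data.List using (List; []; _∷_; _++_; reverse; map)
open import Data.Empty using (⊥)
open import Data.Unit using (⊤)
open import Relation.Nullary using (¬_; yes; no)
open import Relation.Binary.PropositionalEquality using (_≡_)
open import Data.Fin.Properties using () renaming (_≟_ to _≟ᶠ_)
open import Data.Bool.Properties using () renaming (_≟_ to _≟ᵇ_)
open import Data.Product.Properties using (≡-dec)
open import Data.List.Membership.Propositional using (_∈_)

-- The finite generating set S is Fin n.
-- A letter of S ∪ S⁻¹ is (s , b) : b = true means s, b = false means s⁻¹.
Letter : ℕ → Set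
Letter n = Fin n × Bool

Word : ℕ → Set
Word n = List (Letter n)

invL : ∀ {n} → Letter n → Letter n
invL (s , b) = (s , not b)

invW : ∀ {n} → Word n → Word n
invW w = reverse (map invL w)

FreelyReduced : ∀ {n} → Word n → Set
FreelyReduced [] = ⊤
FreelyReduced (x ∷ []) = ⊤
FreelyReduced (x ∷ y ∷ w) = (¬ (y ≡ invL x)) × FreelyReduced (y ∷ w)

-- Sign of a relator occurrence: true = r, false = r⁻¹.
Sign : Set
Sign = Bool

-- A marked word: a string of unmarked letters and marked relator occurrences
-- r^{±1} (the relator word r together with its exponent).
data Item (n : ℕ) : Set where
  letter : Letter n → Item n
  marked : Word n → Sign → Item n

MarkedWord : ℕ → Set
MarkedWord n = List (Item n)

push : ∀ {n} → Item n → MarkedWord n → MarkedWord n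
push (letter x) (letter y ∷ w) with ≡-dec _≟ᶠ_ _≟ᵇ_ y (invL x)
... | yes _ = w
... | no _ = letter x ∷ letter y ∷ w
push i w = i ∷ w

freeReduceSegments : ∀ {n} → MarkedWord n → MarkedWord n
freeReduceSegments [] = []
freeReduceSegments (i ∷ w) = push i (freeReduceSegments w)

data Generated {n : ℕ} (R : List (Word n)) : MarkedWord n → Set where
  empty  : Generated R []
  conj   : ∀ {W} → Generated R W → (x : Letter n) →
           Generated R ((letter (invL x) ∷ W) ++ (letter x ∷ []))
  append : ∀ {W} → Generated R W → (r : Word n) → r ∈ R → (e : Sign) →
           Generated R (W ++ (marked r e ∷ []))

-- One factor u_i⁻¹ r_i^{ε_i} u_i of a proof word: (u_i , r_i , ε_i).
Factor : ℕ → Set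
Factor n = Word n × Word n × Sign

factorRel : ∀ {n} → Factor n → Word n
factorRel (u , r , e) = r

letters : ∀ {n} → Word n → MarkedWord n
letters w = map letter w

proofWord : ∀ {n} → List (Factor n) → MarkedWord n
proofWord [] = []
proofWord ((u , r , e) ∷ fs) =
  letters (invW u) ++ (marked r e ∷ letters u) ++ proofWord fs

-- The segments v_1, …, v_{N+1}: v_1 = u_1⁻¹, v_i = u_{i-1} u_i⁻¹, v_{N+1} = u_N.
-- (segments prev fs) uses prev as u_{i-1}; start with prev = [] .
segments : ∀ {n} → Word n → List (Factor n) → List (Word n)
segments prev [] = prev ∷ []
segments prev ((u , r , e) ∷ fs) = (prev ++ invW u) ∷ segments u fs

-- Conjugating W by u⁻¹, appending r^ε and conjugating by u yields u⁻¹ u W u⁻¹ r^ε u: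
-- the factor u⁻¹ r^ε u is appended at the price of a prefix u⁻¹ u. Appending the
-- factors of U one by one thus generates C U with C = u_N⁻¹ u_N ⋯ u_1⁻¹ u_1. Being
-- pushed onto a reduced word without changing it is a property of ε that is kept
-- under conjugation by a letter and under concatenation, so C disappears under
-- segment-wise free reduction; and U, having freely reduced segments, is its own
-- normal form.
module Submission where

open import Defs
open import Level using (0ℓ)
open import Data.Nat using (ℕ; _≤_)
open import Data.Bool.Properties using (not-involutive) renaming (_≟_ to _≟ᵇ_)
open import Data.Fin.Properties using () renaming (_≟_ to _≟ᶠ_)
open import Data.Product using (Σ; _×_; _,_)
open import Data.Product.Properties using (≡-dec)
open import Data.Unit using (⊤; tt)
open import Data.Empty using (⊥-elim)
open import Data.List using (List; []; _∷_; _++_; [_]; map; reverse; foldr; length)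
open import Data.List.Properties
  using (++-monoid; ++-assoc; ++-identityʳ; map-++; map-∘; map-cong; map-id; foldr-++;
         unfold-reverse; reverse-map; reverse-involutive)
open import Data.List.Relation.Unary.All using (All; _∷_)
open import Data.List.Relation.Unary.Linked using (Linked; []; [-]; _∷_; tail)
open import Data.List.Membership.Propositional using (_∈_)
open import Relation.Nullary using (¬_; yes; no)
open import Relation.Binary.Core using (Rel)
open import Relation.Binary.PropositionalEquality
  using (_≡_; refl; sym; trans; cong; subst; module ≡-Reasoning)
open import Tactic.MonoidSolver using (solve)

module _ {n : ℕ} where

  invL-involutive : (x : Letter n) → invL (invL x) ≡ x
  invL-involutive (s , b) = cong (s ,_) (not-involutive b)

  invW-∷ : (x : Letter n) (w : Word n) → invW (x ∷ w) ≡ invW w ++ [ invL x ]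
  invW-∷ x w = unfold-reverse (invL x) (map invL w)

  invW-involutive : (w : Word n) → invW (invW w) ≡ w
  invW-involutive w = begin
    reverse (map invL (reverse (map invL w)))  ≡⟨ cong reverse (reverse-map invL (map invL w)) ⟩
    reverse (reverse (map invL (map invL w)))  ≡⟨ reverse-involutive _ ⟩
    map invL (map invL w)                      ≡⟨ map-∘ w ⟨
    map (λ x → invL (invL x)) w                ≡⟨ map-cong invL-involutive w ⟩
    map (λ x → x) w                            ≡⟨ map-id w ⟩
    w                                          ∎
    where open ≡-Reasoning

  Uncancelled : Rel (Item n) 0ℓ
  Uncancelled (letter x) (letter y) = ¬ y ≡ invL x
  Uncancelled _          _          = ⊤

  Reduced : MarkedWord n → Set
  Reduced = Linked Uncancelled

  push-reduced : ∀ i w → Reduced (i ∷ w) → push i w ≡ i ∷ w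
  push-reduced (marked _ _) w                 _ = refl
  push-reduced (letter x)   []                _ = refl
  push-reduced (letter x)   (marked _ _ ∷ w)  _ = refl
  push-reduced (letter x)   (letter y ∷ w)    (y≢x⁻¹ ∷ _) with ≡-dec _≟ᶠ_ _≟ᵇ_ y (invL x)
  ... | yes y≡x⁻¹ = ⊥-elim (y≢x⁻¹ y≡x⁻¹)
  ... | no _      = refl

  reduced-push : ∀ i w → Reduced w → Reduced (push i w)
  reduced-push (marked _ _) []                _ = [-]
  reduced-push (marked _ _) (_ ∷ _)           r = tt ∷ r
  reduced-push (letter x)   []                _ = [-]
  reduced-push (letter x)   (marked _ _ ∷ _)  r = tt ∷ r
  reduced-push (letter x)   (letter y ∷ w)    r with ≡-dec _≟ᶠ_ _≟ᵇ_ y (invL x)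
  ... | yes _     = tail r
  ... | no y≢x⁻¹  = y≢x⁻¹ ∷ r

  reduced-freeReduceSegments : ∀ M → Reduced (freeReduceSegments M)
  reduced-freeReduceSegments []      = []
  reduced-freeReduceSegments (i ∷ M) = reduced-push i _ (reduced-freeReduceSegments M)

  freeReduceSegments-reduced : ∀ M → Reduced M → freeReduceSegments M ≡ M
  freeReduceSegments-reduced []      _ = refl
  freeReduceSegments-reduced (i ∷ M) r
    rewrite freeReduceSegments-reduced M (tail r) = push-reduced i M r

  freeReduceSegments-++ : (M N : MarkedWord n) →
                          freeReduceSegments (M ++ N) ≡ foldr push (freeReduceSegments N) M
  freeReduceSegments-++ []      N = refl
  freeReduceSegments-++ (i ∷ M) N = cong (push i) (freeReduceSegments-++ M N)

  push-cancels : ∀ x Z → push (letter (invL x)) (letter x ∷ Z) ≡ Z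
  push-cancels x Z with ≡-dec _≟ᶠ_ _≟ᵇ_ x (invL (invL x))
  ... | yes _        = refl
  ... | no x≢x⁻¹⁻¹   = ⊥-elim (x≢x⁻¹⁻¹ (sym (invL-involutive x)))

  push-inverse : ∀ x Z → Reduced Z → push (letter (invL x)) (push (letter x) Z) ≡ Z
  push-inverse x []               _ = push-cancels x []
  push-inverse x (marked r e ∷ Z) _ = push-cancels x (marked r e ∷ Z)
  push-inverse x (letter y ∷ Z)   r with ≡-dec _≟ᶠ_ _≟ᵇ_ y (invL x)
  ... | no _     = push-cancels x (letter y ∷ Z)
  ... | yes refl = push-reduced (letter (invL x)) Z r

  reduced-letters : ∀ w → FreelyReduced w → Reduced (letters w)
  reduced-letters []          _            = []
  reduced-letters (x ∷ [])    _            = [-]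
  reduced-letters (x ∷ y ∷ w) (y≢x⁻¹ , fr) = y≢x⁻¹ ∷ reduced-letters (y ∷ w) fr

  reduced-letters-marked : ∀ w r e {M} → FreelyReduced w → Reduced M →
                           Reduced (letters w ++ marked r e ∷ M)
  reduced-letters-marked []          r e {[]}    _            _  = [-]
  reduced-letters-marked []          r e {_ ∷ _} _            rM = tt ∷ rM
  reduced-letters-marked (x ∷ [])    r e         _            rM =
    tt ∷ reduced-letters-marked [] r e _ rM
  reduced-letters-marked (x ∷ y ∷ w) r e         (y≢x⁻¹ , fr) rM =
    y≢x⁻¹ ∷ reduced-letters-marked (y ∷ w) r e fr rM

  reduced-proofWord : ∀ v fs → All FreelyReduced (segments v fs) →
                      Reduced (letters v ++ proofWord fs)
  reduced-proofWord v [] (fr ∷ _) =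
    subst Reduced (sym (++-identityʳ (letters v))) (reduced-letters v fr)
  reduced-proofWord v ((u , r , e) ∷ fs) (fr ∷ frs) =
    subst Reduced eq (reduced-letters-marked (v ++ invW u) r e fr (reduced-proofWord u fs frs))
    where
    eq : letters (v ++ invW u) ++ marked r e ∷ letters u ++ proofWord fs
       ≡ letters v ++ proofWord ((u , r , e) ∷ fs)
    eq rewrite map-++ letter v (invW u) = ++-assoc (letters v) (letters (invW u)) _

  conjugate : Letter n → MarkedWord n → MarkedWord n
  conjugate x W = letter (invL x) ∷ W ++ [ letter x ]

  conjugateWord : Word n → MarkedWord n → MarkedWord n
  conjugateWord w W = letters (invW w) ++ W ++ letters w

  conjugateWord-∷ : ∀ x w W → conjugateWord w (conjugate x W) ≡ conjugateWord (x ∷ w) W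
  conjugateWord-∷ x w W
    rewrite invW-∷ x w | map-++ letter (invW w) [ invL x ]
    = regroup (letters (invW w)) [ letter (invL x) ] W [ letter x ] (letters w)
    where
    regroup : ∀ {A : Set} (a p m q b : List A) →
              a ++ (p ++ m ++ q) ++ b ≡ (a ++ p) ++ m ++ q ++ b
    regroup {A} _ _ _ _ _ = solve (++-monoid A)

  conjugateWord-closed : (P : MarkedWord n → Set) → (∀ x {W} → P W → P (conjugate x W)) →
                         ∀ w {W} → P W → P (conjugateWord w W)
  conjugateWord-closed P P-conj []      {W} p = subst P (sym (++-identityʳ W)) p
  conjugateWord-closed P P-conj (x ∷ w) {W} p =
    subst P (conjugateWord-∷ x w W) (conjugateWord-closed P P-conj w (P-conj x p))

  record Cancels (C : MarkedWord n) : Set where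
    constructor cancelling
    field cancels : ∀ Y → Reduced Y → foldr push Y C ≡ Y
  open Cancels

  cancels-[] : Cancels []
  cancels-[] = cancelling λ _ _ → refl

  cancels-++ : ∀ {C D} → Cancels C → Cancels D → Cancels (C ++ D)
  cancels-++ {C} {D} cC cD = cancelling λ Y r → begin
    foldr push Y (C ++ D)          ≡⟨ foldr-++ push Y C D ⟩
    foldr push (foldr push Y D) C  ≡⟨ cong (λ Z → foldr push Z C) (cancels cD Y r) ⟩
    foldr push Y C                 ≡⟨ cancels cC Y r ⟩
    Y                              ∎
    where open ≡-Reasoning

  cancels-conjugate : ∀ x {C} → Cancels C → Cancels (conjugate x C)
  cancels-conjugate x {C} cC = cancelling λ Y r → begin
    push x⁻¹ (foldr push Y (C ++ [ letter x ]))  ≡⟨ cong (push x⁻¹) (foldr-++ push Y C _) ⟩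
    push x⁻¹ (foldr push (push (letter x) Y) C)
      ≡⟨ cong (push x⁻¹) (cancels cC _ (reduced-push (letter x) Y r)) ⟩
    push x⁻¹ (push (letter x) Y)                 ≡⟨ push-inverse x Y r ⟩
    Y                                            ∎
    where
    open ≡-Reasoning
    x⁻¹ = letter (invL x)

  cancels-invW-++ : ∀ u → Cancels (letters (invW u) ++ letters u)
  cancels-invW-++ u = conjugateWord-closed Cancels cancels-conjugate u cancels-[]

  freeReduceSegments-cancels : ∀ {C} → Cancels C → ∀ M →
                               freeReduceSegments (C ++ M) ≡ freeReduceSegments M
  freeReduceSegments-cancels {C} cC M = begin
    freeReduceSegments (C ++ M)             ≡⟨ freeReduceSegments-++ C M ⟩
    foldr push (freeReduceSegments M) C     ≡⟨ cancels cC _ (reduced-freeReduceSegments M) ⟩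
    freeReduceSegments M                    ∎
    where open ≡-Reasoning

  factorWord : Factor n → MarkedWord n
  factorWord (u , r , e) = letters (invW u) ++ [ marked r e ] ++ letters u

  proofWord-∷ : ∀ f fs → proofWord (f ∷ fs) ≡ factorWord f ++ proofWord fs
  proofWord-∷ (u , r , e) fs =
    sym (++-assoc (letters (invW u)) (marked r e ∷ letters u) (proofWord fs))

  module _ (R : List (Word n)) where

    generated-conjugateWord : ∀ w {W} → Generated R W → Generated R (conjugateWord w W)
    generated-conjugateWord = conjugateWord-closed (Generated R) (λ x g → conj g x)

    generated-factor : ∀ {C P} u r e → r ∈ R → Generated R (C ++ P) →
      Generated R (((letters (invW u) ++ letters u) ++ C) ++ P ++ factorWord (u , r , e))
    generated-factor {C} {P} u r e r∈R g =
      subst (Generated R) (regroup (letters (invW u)) (letters u) C P [ marked r e ])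
        (generated-conjugateWord u
          (append (subst (Generated R) u⁻¹⁻¹≡u (generated-conjugateWord (invW u) g)) r r∈R e))
      where
      regroup : ∀ {A : Set} (a b c p q : List A) →
                a ++ ((b ++ (c ++ p) ++ a) ++ q) ++ b ≡ ((a ++ b) ++ c) ++ p ++ a ++ q ++ b
      regroup {A} _ _ _ _ _ = solve (++-monoid A)

      u⁻¹⁻¹≡u : conjugateWord (invW u) (C ++ P) ≡ letters u ++ (C ++ P) ++ letters (invW u)
      u⁻¹⁻¹≡u = cong (λ v → letters v ++ (C ++ P) ++ letters (invW u)) (invW-involutive u)

    generated-proofWord : ∀ fs → All (λ f → factorRel f ∈ R) fs →
      ∀ {C P} → Cancels C → Generated R (C ++ P) →
      Σ (MarkedWord n) (λ C′ → Cancels C′ × Generated R (C′ ++ P ++ proofWord fs))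
    generated-proofWord [] _ {C} {P} cC g =
      C , cC , subst (λ Q → Generated R (C ++ Q)) (sym (++-identityʳ P)) g
    generated-proofWord ((u , r , e) ∷ fs) (r∈R ∷ rels) {C} {P} cC g
      with generated-proofWord fs rels {P = P ++ factorWord (u , r , e)}
             (cancels-++ (cancels-invW-++ u) cC) (generated-factor u r e r∈R g)
    ... | C′ , cC′ , g′ = C′ , cC′ , subst (λ Q → Generated R (C′ ++ Q)) eq g′
      where
      eq : (P ++ factorWord (u , r , e)) ++ proofWord fs ≡ P ++ proofWord ((u , r , e) ∷ fs)
      eq = trans (++-assoc P _ _) (cong (P ++_) (sym (proofWord-∷ (u , r , e) fs)))

theorem1 : (n : ℕ) (R : List (Word n)) (fs : List (Factor n)) →
    1 ≤ length fs →
    All (λ f → factorRel f ∈ R) fs →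
    All FreelyReduced (segments [] fs) →
    Σ (MarkedWord n) (λ W → Generated R W × (freeReduceSegments W ≡ proofWord fs))
theorem1 n R fs _ rels reduced
  with generated-proofWord R fs rels {[]} {[]} cancels-[] empty
... | C , cC , g = C ++ proofWord fs , g , (begin
  freeReduceSegments (C ++ proofWord fs)  ≡⟨ freeReduceSegments-cancels cC (proofWord fs) ⟩
  freeReduceSegments (proofWord fs)       ≡⟨ freeReduceSegments-reduced _ (reduced-proofWord [] fs reduced) ⟩
  proofWord fs                            ∎)
  where open ≡-Reasoning
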